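{- Let $G=\{M_1,\dots,M_r\}\subseteq{\rm H}(3,\mathbb{Q})$ with $\psi(M_i)=(a_i,b_i,c_i)$, and suppose the superdiagonal vectors of the matrices in $G$ are pairwise parallel. If there exists a product $M=M_{i_1}M_{i_2}\cdots M_{i_k}$ with $i_j\in[1,r]$ for all $1\le j\le k$ such that $\psi(M)=(0,0,c)$ for some $c\in\mathbb{Q}$, then $$c=\sum_{j=1}^{k}\Big(c_{i_j}-\frac{q}{2}a_{i_j}^2\Big)$$ for some $q\in\mathbb{Q}$ depending only on $G$.
   Context: ${\rm H}(3,\mathbb{Q})$ is the group of matrices $\begin{pmatrix}1&a&c\\0&1&b\\0&0&1\end{pmatrix}$ with $a,b,c\in\mathbb{Q}$; for such $M$, $\psi(M)=(a,b,c)$ and its superdiagonal vector is $(a,b)$. Two vectors $(u_1,u_2),(v_1,v_2)$ are parallel if $u_1v_2-u_2v_1=0$. -}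

module Defs where

open import Data.Nat using (ℕ; zero; suc)
open import Data.Fin using (Fin; zero; suc)
open import Data.Rational using (ℚ; 0ℚ; 1ℚ; ½; _+_; _*_; _-_)
open import Data.Product using (_×_; _,_)
open import Relation.Binary.PropositionalEquality using (_≡_)

Mat3 : Set
Mat3 = Fin 3 → Fin 3 → ℚ

i0 i1 i2 : Fin 3
i0 = zero
i1 = suc zero
i2 = suc (suc zero)

_⊗_ : Mat3 → Mat3 → Mat3
(M ⊗ N) i j = M i i0 * N i0 j + M i i1 * N i1 j + M i i2 * N i2 j

I3 : Mat3
I3 zero zero = 1ℚ
I3 (suc zero) (suc zero) = 1ℚ
I3 (suc (suc zero)) (suc (suc zero)) = 1ℚ
I3 _ _ = 0ℚ

InH3 : Mat3 → Set
InH3 M = (M i0 i0 ≡ 1ℚ) × (M i1 i1 ≡ 1ℚ) × (M i2 i2 ≡ 1ℚ)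
       × (M i1 i0 ≡ 0ℚ) × (M i2 i0 ≡ 0ℚ) × (M i2 i1 ≡ 0ℚ)

-- ψ(M) = (a, b, c) for M = [[1,a,c],[0,1,b],[0,0,1]]
ψ : Mat3 → ℚ × ℚ × ℚ
ψ M = M i0 i1 , M i1 i2 , M i0 i2

superdiag : Mat3 → ℚ × ℚ
superdiag M = M i0 i1 , M i1 i2

Parallel : ℚ × ℚ → ℚ × ℚ → Set
Parallel (u₁ , u₂) (v₁ , v₂) = u₁ * v₂ - u₂ * v₁ ≡ 0ℚ

prodW : ∀ {r} (M : Fin r → Mat3) (k : ℕ) → (Fin k → Fin r) → Mat3
prodW M zero w = I3
prodW M (suc k) w = M (w zero) ⊗ prodW M k (λ j → w (suc j))

sumQ : (k : ℕ) → (Fin k → ℚ) → ℚ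
sumQ zero f = 0ℚ
sumQ (suc k) f = f zero + sumQ k (λ j → f (suc j))

entA entB entC : Mat3 → ℚ
entA M = M i0 i1
entB M = M i1 i2
entC M = M i0 i2

-- Pairwise parallel superdiagonal vectors (a_i , b_i) lie on one line b = q a (or are all
-- vertical).  In a product N P the superdiagonal entries add and the corner picks up
-- a_N b_P = q a_N a_P, so by completing the square c - (q/2) a² is additive along products.
-- A central product has a = 0, hence its corner c is the sum of the c_i - (q/2) a_i².
module Submission where

open import Defs
open import Data.Nat using (ℕ; zero; suc; _≤_)
open import Data.Fin using (Fin; zero; suc)
open import Data.Fin.Properties using (any?) renaming (_≟_ to _≟ᶠ_)
open import Data.Product using (Σ; _,_; proj₁; proj₂)
open import Data.Rational using (ℚ; NonZero; 0ℚ; 1ℚ; ½; _+_; _*_; _-_; 1/_; _÷_; ≢-nonZero)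
open import Data.Rational.Properties using (_≟_; +-*-commutativeRing; +-0-group; +-identityˡ; +-identityʳ; *-identityˡ; *-comm; *-assoc; *-inverseˡ; *-zeroˡ; *-zeroʳ; *-distribˡ-+)
open import Algebra.Properties.Group +-0-group using (x∙y⁻¹≈ε⇒x≈y)
open import Function using (_∘_)
open import Level using (0ℓ)
open import Relation.Binary.PropositionalEquality
open import Relation.Nullary using (yes; no; ¬?)
open import Relation.Nullary.Decidable using (dec⇒maybe; decidable-stable)
open import Tactic.RingSolver using (solve-∀)
open import Tactic.RingSolver.Core.AlmostCommutativeRing using (AlmostCommutativeRing; fromCommutativeRing)

ℚ-ring : AlmostCommutativeRing 0ℓ 0ℓ
ℚ-ring = fromCommutativeRing +-*-commutativeRing (dec⇒maybe ∘ (0ℚ ≟_))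

InH3-⊗ : ∀ N P → InH3 N → InH3 P → InH3 (N ⊗ P)
InH3-⊗ N P (n00 , n11 , n22 , n10 , n20 , n21) (p00 , p11 , p22 , p10 , p20 , p21)
  rewrite n00 | n11 | n22 | n10 | n20 | n21 | p00 | p11 | p22 | p10 | p20 | p21 =
  e00 (N i0 i1) (N i0 i2) , e11 (P i0 i1) (N i1 i2) , e22 (P i0 i2) (P i1 i2) ,
  e10 (N i1 i2) , e20 , e21 (P i0 i1)
  where
  e00 : ∀ x y → 1ℚ * 1ℚ + x * 0ℚ + y * 0ℚ ≡ 1ℚ
  e00 = solve-∀ ℚ-ring
  e11 : ∀ x y → 0ℚ * x + 1ℚ * 1ℚ + y * 0ℚ ≡ 1ℚ
  e11 = solve-∀ ℚ-ring
  e22 : ∀ x y → 0ℚ * x + 0ℚ * y + 1ℚ * 1ℚ ≡ 1ℚ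
  e22 = solve-∀ ℚ-ring
  e10 : ∀ x → 0ℚ * 1ℚ + 1ℚ * 0ℚ + x * 0ℚ ≡ 0ℚ
  e10 = solve-∀ ℚ-ring
  e20 : 0ℚ * 1ℚ + 0ℚ * 0ℚ + 1ℚ * 0ℚ ≡ 0ℚ
  e20 = solve-∀ ℚ-ring
  e21 : ∀ x → 0ℚ * x + 0ℚ * 1ℚ + 1ℚ * 0ℚ ≡ 0ℚ
  e21 = solve-∀ ℚ-ring

entA-⊗ : ∀ N P → InH3 N → InH3 P → entA (N ⊗ P) ≡ entA N + entA P
entA-⊗ N P (n00 , _) (_ , p11 , _ , _ , _ , p21) rewrite n00 | p11 | p21 =
  e (N i0 i1) (P i0 i1) (N i0 i2)
  where
  e : ∀ a a′ c → 1ℚ * a′ + a * 1ℚ + c * 0ℚ ≡ a + a′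
  e = solve-∀ ℚ-ring

entB-⊗ : ∀ N P → InH3 N → InH3 P → entB (N ⊗ P) ≡ entB N + entB P
entB-⊗ N P (_ , n11 , _ , n10 , _) (_ , _ , p22 , _) rewrite n11 | n10 | p22 =
  e (N i1 i2) (P i1 i2) (P i0 i2)
  where
  e : ∀ b b′ c′ → 0ℚ * c′ + 1ℚ * b′ + b * 1ℚ ≡ b + b′
  e = solve-∀ ℚ-ring

entC-⊗ : ∀ N P → InH3 N → InH3 P → entC (N ⊗ P) ≡ entC N + entA N * entB P + entC P
entC-⊗ N P (n00 , _) (_ , _ , p22 , _) rewrite n00 | p22 =
  e (N i0 i1) (N i0 i2) (P i1 i2) (P i0 i2)
  where
  e : ∀ a c b′ c′ → 1ℚ * c′ + a * b′ + c * 1ℚ ≡ c + a * b′ + c′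
  e = solve-∀ ℚ-ring

complete-square : ∀ q c a S a′ →
  c + q * (a * a′) + (S + q * ½ * (a′ * a′)) ≡ (c - q * ½ * (a * a)) + S + q * ½ * ((a + a′) * (a + a′))
complete-square = solve-∀ ℚ-ring

-- b = q a, multiplied through by a so that it also covers the case where every a is 0.
CommonSlope : ∀ {r} → (Fin r → Mat3) → ℚ → Set
CommonSlope M q = ∀ i j → entA (M i) * entB (M j) ≡ q * (entA (M i) * entA (M j))

correctedC : ℚ → Mat3 → ℚ
correctedC q N = entC N - (q * ½) * (entA N * entA N)

module _ {r} (M : Fin r → Mat3) (M∈H3 : ∀ i → InH3 (M i)) where

  InH3-prodW : ∀ k w → InH3 (prodW M k w)
  InH3-prodW zero    w = refl , refl , refl , refl , refl , refl
  InH3-prodW (suc k) w =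
    InH3-⊗ (M (w zero)) (prodW M k (w ∘ suc)) (M∈H3 (w zero)) (InH3-prodW k (w ∘ suc))

  module _ (q : ℚ) (slope : CommonSlope M q) where

    CommonSlope-prodW : ∀ k w i → entA (M i) * entB (prodW M k w) ≡ q * (entA (M i) * entA (prodW M k w))
    CommonSlope-prodW zero w i = begin
      a * 0ℚ        ≡⟨ *-zeroʳ a ⟩
      0ℚ            ≡⟨ *-zeroʳ q ⟨
      q * 0ℚ        ≡⟨ cong (q *_) (*-zeroʳ a) ⟨
      q * (a * 0ℚ)  ∎
      where
      open ≡-Reasoning
      a = entA (M i)
    CommonSlope-prodW (suc k) w i = begin
      a * entB (N ⊗ P)                    ≡⟨ cong (a *_) (entB-⊗ N P N∈H3 P∈H3) ⟩
      a * (entB N + entB P)               ≡⟨ *-distribˡ-+ a (entB N) (entB P) ⟩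
      a * entB N + a * entB P             ≡⟨ cong₂ _+_ (slope i (w zero)) (CommonSlope-prodW k (w ∘ suc) i) ⟩
      q * (a * entA N) + q * (a * entA P) ≡⟨ *-distribˡ-+ q _ _ ⟨
      q * (a * entA N + a * entA P)       ≡⟨ cong (q *_) (*-distribˡ-+ a (entA N) (entA P)) ⟨
      q * (a * (entA N + entA P))         ≡⟨ cong (λ t → q * (a * t)) (entA-⊗ N P N∈H3 P∈H3) ⟨
      q * (a * entA (N ⊗ P))              ∎
      where
      open ≡-Reasoning
      a = entA (M i)
      N = M (w zero)
      P = prodW M k (w ∘ suc)
      N∈H3 = M∈H3 (w zero)
      P∈H3 = InH3-prodW k (w ∘ suc)

    entC-prodW : ∀ k w → entC (prodW M k w) ≡
                 sumQ k (correctedC q ∘ M ∘ w) + q * ½ * (entA (prodW M k w) * entA (prodW M k w))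
    entC-prodW zero    w = sym (trans (+-identityˡ _) (*-zeroʳ (q * ½)))
    entC-prodW (suc k) w = begin
      entC (N ⊗ P)                                       ≡⟨ entC-⊗ N P N∈H3 P∈H3 ⟩
      entC N + entA N * entB P + entC P                  ≡⟨ cong₂ (λ x y → entC N + x + y)
                                                              (CommonSlope-prodW k (w ∘ suc) (w zero))
                                                              (entC-prodW k (w ∘ suc)) ⟩
      entC N + q * (entA N * entA P) + (S + q * ½ * (entA P * entA P))
                                                         ≡⟨ complete-square q (entC N) (entA N) S (entA P) ⟩
      correctedC q N + S + q * ½ * ((entA N + entA P) * (entA N + entA P))
                                                         ≡⟨ cong (λ x → correctedC q N + S + q * ½ * (x * x)) (entA-⊗ N P N∈H3 P∈H3) ⟨
      correctedC q N + S + q * ½ * (entA (N ⊗ P) * entA (N ⊗ P)) ∎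
      where
      open ≡-Reasoning
      N = M (w zero)
      P = prodW M k (w ∘ suc)
      N∈H3 = M∈H3 (w zero)
      P∈H3 = InH3-prodW k (w ∘ suc)
      S = sumQ k (correctedC q ∘ M ∘ w ∘ suc)

    central-prodW-entC : ∀ k w c → ψ (prodW M k w) ≡ (0ℚ , 0ℚ , c) → c ≡ sumQ k (correctedC q ∘ M ∘ w)
    central-prodW-entC k w c ψ≡ = begin
      c                              ≡⟨ cong (proj₂ ∘ proj₂) ψ≡ ⟨
      entC P                         ≡⟨ entC-prodW k w ⟩
      S + q * ½ * (entA P * entA P)  ≡⟨ cong (λ a → S + q * ½ * (a * a)) (cong proj₁ ψ≡) ⟩
      S + q * ½ * 0ℚ                 ≡⟨ cong (S +_) (*-zeroʳ (q * ½)) ⟩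
      S + 0ℚ                         ≡⟨ +-identityʳ S ⟩
      S                              ∎
      where
      open ≡-Reasoning
      P = prodW M k w
      S = sumQ k (correctedC q ∘ M ∘ w)

module _ {r} (M : Fin r → Mat3) where

  CommonSlope-vertical : (∀ i → entA (M i) ≡ 0ℚ) → ∀ q → CommonSlope M q
  CommonSlope-vertical vertical q i j rewrite vertical i =
    trans (*-zeroˡ (entB (M j))) (sym (trans (cong (q *_) (*-zeroˡ (entA (M j)))) (*-zeroʳ q)))

  CommonSlope-pivot : ∀ i .{{_ : NonZero (entA (M i))}} →
                      (∀ j → entA (M i) * entB (M j) ≡ entB (M i) * entA (M j)) →
                      CommonSlope M (entB (M i) ÷ entA (M i))
  CommonSlope-pivot i cross k j = begin
    aₖ * entB (M j)                       ≡⟨ cong (aₖ *_) (*-identityˡ _) ⟨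
    aₖ * (1ℚ * entB (M j))                ≡⟨ cong (λ t → aₖ * (t * entB (M j))) (*-inverseˡ aᵢ) ⟨
    aₖ * ((1/ aᵢ * aᵢ) * entB (M j))      ≡⟨ cong (aₖ *_) (*-assoc (1/ aᵢ) aᵢ _) ⟩
    aₖ * (1/ aᵢ * (aᵢ * entB (M j)))      ≡⟨ cong (λ t → aₖ * (1/ aᵢ * t)) (cross j) ⟩
    aₖ * (1/ aᵢ * (entB (M i) * entA (M j))) ≡⟨ rearrange aₖ (1/ aᵢ) (entB (M i)) (entA (M j)) ⟩
    entB (M i) * (1/ aᵢ) * (aₖ * entA (M j)) ∎
    where
    open ≡-Reasoning
    aᵢ = entA (M i)
    aₖ = entA (M k)
    rearrange : ∀ x u b y → x * (u * (b * y)) ≡ b * u * (x * y)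
    rearrange = solve-∀ ℚ-ring

  parallel⇒CommonSlope : (∀ i j → i ≢ j → Parallel (superdiag (M i)) (superdiag (M j))) →
                         Σ ℚ (CommonSlope M)
  parallel⇒CommonSlope parallel with any? (λ i → ¬? (entA (M i) ≟ 0ℚ))
  ... | yes (i , aᵢ≢0) = entB (M i) ÷ entA (M i) , CommonSlope-pivot i cross
    where
    instance _ = ≢-nonZero aᵢ≢0
    cross : ∀ j → entA (M i) * entB (M j) ≡ entB (M i) * entA (M j)
    cross j with i ≟ᶠ j
    ... | yes refl = *-comm (entA (M i)) (entB (M i))
    ... | no  i≢j  = x∙y⁻¹≈ε⇒x≈y (entA (M i) * entB (M j)) (entB (M i) * entA (M j)) (parallel i j i≢j)
  ... | no ∄aᵢ≢0 = 0ℚ , CommonSlope-vertical (λ i → decidable-stable (_ ≟ 0ℚ) (∄aᵢ≢0 ∘ (i ,_))) 0ℚ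

lemma12 : (r : ℕ) (M : Fin r → Mat3)
    → ((i : Fin r) → InH3 (M i))
    → ((i j : Fin r) → i ≢ j → Parallel (superdiag (M i)) (superdiag (M j)))
    → Σ ℚ λ q → (k : ℕ) → 1 ≤ k → (w : Fin k → Fin r) → (c : ℚ)
    → ψ (prodW M k w) ≡ (0ℚ , 0ℚ , c)
    → c ≡ sumQ k (λ j → entC (M (w j)) - (q * ½) * (entA (M (w j)) * entA (M (w j))))
lemma12 r M M∈H3 parallel with parallel⇒CommonSlope M parallel
... | q , slope = q , λ k _ → central-prodW-entC M M∈H3 q slope k
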